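{- Let $R$ be a poset on a finite set $X$ avoiding $\mathbf{2+2}$ and $\mathbf{3+1}$, with Fishburn matrix $M$; for a cell $c$ let $X_c$ be the set of elements represented by $c$. Let $T$ be a relation on $X$ such that: (a) for every nonzero cell $c$, the restriction of $T$ to $X_c$ is a linear order; (b) if $c,d$ are distinct nonzero cells with $c$ weakly NW from $d$, then $xTy$ for all $x\in X_c$, $y\in X_d$; (c) apart from the pairs described in (a) and (b), no other pair $(x,y)\in X^2$ belongs to $T$ or is $T$-comparable. Then $(T,R)$ is a Catalan pair of type 2. Moreover, if $(T',R)$ is another Catalan pair of type 2, then $(T,R)$ and $(T',R)$ are isomorphic relational structures. Consequently, on an $n$-element set there are $C_n=\frac{1}{n+1}\binom{2n}{n}$ isomorphism types of Catalan pairs of type 2.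
   Context: A Catalan pair of type 2 is a pair $(T,R)$ of relations on a finite set $X$ with: (C2a) $R$ and $T\cup R$ are partial orders (irreflexive transitive relations); (C2b) any two distinct elements are comparable (i.e. $xRy$ or $yRx$, resp. for $T$) by exactly one of $T$, $R$; (C2c) no three distinct $x,y,z$ with $xTy$, $xTz$, $yRz$, and no three $x,y,z$ with $yTx$, $zTx$, $yRz$. Two relational structures $(T,R)$ on $X$ and $(T',R')$ on $Y$ are isomorphic if there is a bijection $\phi:X\to Y$ with $xTy\iff\phi(x)T'\phi(y)$ and $xRy\iff \phi(x)R'\phi(y)$. $\mathbf{2+2}$: poset with only relations $a<b$, $c<d$; $\mathbf{3+1}$: poset with only relations $a<b<c$. An interval order ($\mathbf{2+2}$-free poset) has a unique minimal interval representation $x\mapsto[l_x,r_x]$ with positive integer endpoints, $x\prec y$ iff $r_x<l_y$, every $k\in\{1,\dots,m\}$ both a left and a right endpoint; its Fishburn matrix is the $m\times m$ matrix with $M_{i,j}=|\{x:[l_x,r_x]=[i,j]\}|$ (rows top to bottom), $x$ being represented by cell $(i,j)$. For cells $c=(i,j)$, $c'=(i',j')$ ($i\le j$, $i'\le j'$): $c$ is greater than $c'$ if $j'<i$, comparable if one is greater. $c$ is North of $c'$ if $i<i'$, $j=j'$; West of $c'$ if $i=i'$, $j<j'$; strictly NW of $c'$ if $c,c'$ are incomparable and $i<i'$, $j<j'$; weakly NW if North, West or strictly NW. -}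

module Defs where

open import Data.Nat using (ℕ; zero; suc; _<_; _≤_; _/_)
open import Data.Nat.Combinatorics using (_C_)
open import Data.Fin using (Fin)
open import Data.Bool using (Bool)
import Data.Bool as B
open import Data.Product using (Σ; ∃; _×_; _,_; proj₁; proj₂)
open import Data.Sum using (_⊎_)
open import Relation.Nullary using (¬_)
open import Relation.Binary.PropositionalEquality using (_≡_; _≢_)
open import Function.Bundles using (_⇔_; _↔_; Inverse)

Rel : ℕ → Set₁
Rel n = Fin n → Fin n → Set

module _ {n : ℕ} where

  Irreflexive : Rel n → Set
  Irreflexive R = ∀ x → ¬ R x x

  Transitive : Rel n → Set
  Transitive R = ∀ x y z → R x y → R y z → R x z

  IsStrictPartialOrder : Rel n → Set
  IsStrictPartialOrder R = Irreflexive R × Transitive R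

  _∪_ : Rel n → Rel n → Rel n
  (T ∪ R) x y = T x y ⊎ R x y

  Comparable : Rel n → Fin n → Fin n → Set
  Comparable R x y = R x y ⊎ R y x

  Incomparable : Rel n → Fin n → Fin n → Set
  Incomparable R x y = ¬ R x y × ¬ R y x

  Distinct3 : Fin n → Fin n → Fin n → Set
  Distinct3 x y z = x ≢ y × x ≢ z × y ≢ z

  IsCatalanPair2 : Rel n → Rel n → Set
  IsCatalanPair2 T R =
    IsStrictPartialOrder R × IsStrictPartialOrder (T ∪ R)
    × (∀ x y → x ≢ y →
         (Comparable T x y ⊎ Comparable R x y)
         × ¬ (Comparable T x y × Comparable R x y))
    × (∀ x y z → Distinct3 x y z → ¬ (T x y × T x z × R y z))
    × (∀ x y z → Distinct3 x y z → ¬ (T y x × T z x × R y z))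

  Free-2+2 : Rel n → Set
  Free-2+2 R = ∀ a b c d → R a b → R c d →
    ¬ (Incomparable R a c × Incomparable R a d
       × Incomparable R b c × Incomparable R b d)

  Free-3+1 : Rel n → Set
  Free-3+1 R = ∀ a b c d → R a b → R b c →
    ¬ (Incomparable R d a × Incomparable R d b × Incomparable R d c)

  -- The (unique) minimal interval representation x ↦ [l x , r x] of an
  -- interval order R, with endpoints in {1,…,m}; every k ∈ {1,…,m} is both a
  -- left and a right endpoint.  The Fishburn matrix is the m×m matrix
  -- counting elements with interval [i , j]; x is represented by cell
  -- (l x , r x).
  record MinIntervalRep (R : Rel n) : Set₁ where
    field
      m        : ℕ
      l r      : Fin n → ℕ
      l-pos    : ∀ x → 1 ≤ l x
      l≤r      : ∀ x → l x ≤ r x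
      r≤m      : ∀ x → r x ≤ m
      repr     : ∀ x y → R x y ⇔ (r x < l y)
      leftEnd  : ∀ k → 1 ≤ k → k ≤ m → ∃ λ x → l x ≡ k
      rightEnd : ∀ k → 1 ≤ k → k ≤ m → ∃ λ x → r x ≡ k

-- Cells of a Fishburn matrix: c = (i , j) with i ≤ j

Cell : Set
Cell = ℕ × ℕ

CellGreater : Cell → Cell → Set
CellGreater (i , j) (i' , j') = j' < i

CellComparable : Cell → Cell → Set
CellComparable c c' = CellGreater c c' ⊎ CellGreater c' c

North : Cell → Cell → Set
North (i , j) (i' , j') = i < i' × j ≡ j'

West : Cell → Cell → Set
West (i , j) (i' , j') = i ≡ i' × j < j'

StrictlyNW : Cell → Cell → Set
StrictlyNW (i , j) (i' , j') =
  ¬ CellComparable (i , j) (i' , j') × i < i' × j < j'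

WeaklyNW : Cell → Cell → Set
WeaklyNW c c' = North c c' ⊎ West c c' ⊎ StrictlyNW c c'

module _ {n : ℕ} {R : Rel n} (ρ : MinIntervalRep R) where
  open MinIntervalRep ρ

  cell : Fin n → Cell
  cell x = (l x , r x)

  CellLinear : Rel n → Set
  CellLinear T =
      (∀ x → ¬ T x x)
    × (∀ x y z → cell x ≡ cell y → cell y ≡ cell z → T x y → T y z → T x z)
    × (∀ x y → cell x ≡ cell y → x ≢ y → T x y ⊎ T y x)

  CellNW : Rel n → Set
  CellNW T = ∀ x y → cell x ≢ cell y → WeaklyNW (cell x) (cell y) → T x y

  NoOtherPairs : Rel n → Set
  NoOtherPairs T = ∀ x y → T x y →
    cell x ≡ cell y ⊎ (cell x ≢ cell y × WeaklyNW (cell x) (cell y))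

Iso : {n : ℕ} → Rel n → Rel n → Rel n → Rel n → Set
Iso {n} T R T' R' = Σ (Fin n ↔ Fin n) λ φ →
  let f = Inverse.to φ in
  ∀ x y → (T x y ⇔ T' (f x) (f y)) × (R x y ⇔ R' (f x) (f y))

BRel : ℕ → Set
BRel n = Fin n → Fin n → Bool

⟦_⟧ : {n : ℕ} → BRel n → Rel n
⟦ f ⟧ x y = B.T (f x y)

catalan : ℕ → ℕ
catalan n = ((n Data.Nat.+ n) C n) / suc n

HasIsoTypes : ℕ → ℕ → Set
HasIsoTypes n k = Σ (Fin k → BRel n × BRel n) λ P →
    (∀ i → IsCatalanPair2 ⟦ proj₁ (P i) ⟧ ⟦ proj₂ (P i) ⟧)
  × (∀ i j → Iso ⟦ proj₁ (P i) ⟧ ⟦ proj₂ (P i) ⟧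
                 ⟦ proj₁ (P j) ⟧ ⟦ proj₂ (P j) ⟧ → i ≡ j)
  × (∀ (T R : BRel n) → IsCatalanPair2 ⟦ T ⟧ ⟦ R ⟧ →
       ∃ λ i → Iso ⟦ T ⟧ ⟦ R ⟧ ⟦ proj₁ (P i) ⟧ ⟦ proj₂ (P i) ⟧)

module Submission where

-- For a Catalan pair (T, R) the union T ∪ R is a strict total order, and by (C2c) the
-- R-predecessors of any element form an initial segment of it.  Listing the elements along
-- T ∪ R, the pair is therefore determined up to isomorphism by its profile g: the j-th element
-- has exactly the first g j elements as R-predecessors, and g is weakly increasing with g j ≤ j.
-- The profile depends on R alone, since the number of elements with at most k R-predecessors
-- does; hence Catalan pairs with the same R are isomorphic.  An isomorphism between the
-- canonical pairs of two profiles preserves the natural order of Fin n, so it is the identity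
-- and the profiles agree.  Profiles of length n are ballot sequences, of which there are
-- C(2n, n) - C(2n, n + 1) = C_n.
-- For the pair built from a Fishburn matrix, 3+1-freeness of R forbids strictly nested
-- intervals in the minimal representation, so two elements with overlapping intervals lie in
-- cells one of which is weakly NW of the other; this makes T ∪ R transitive and total.

open import Defs
open import Data.Nat using (ℕ; zero; suc; _+_; _*_; _/_; _≤_; _<_; _≤?_; _<?_; z≤n; s≤s)
open import Data.Nat.Properties
open import Data.Nat.Combinatorics using (_C_; nCk≡nC[n∸k]; nCn≡1; nC1≡n; k>n⇒nCk≡0; nCk+nC[k+1]≡[n+1]C[k+1])
open import Data.Nat.DivMod using (m*n/n≡m)
open import Data.Bool.Properties using (T?)
open import Data.Fin using (Fin; zero; suc; toℕ; fromℕ<; punchOut; inject₁) renaming (_≟_ to _≟ᶠ_; _<_ to _<ᶠ_; _≤_ to _≤ᶠ_)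
open import Data.Fin.Properties using (toℕ-injective; toℕ-fromℕ<; toℕ<n; any?; pigeonhole; punchOut-injective)
import Data.Fin.Properties as Finₚ
open import Data.Fin.Induction using (<-weakInduction)
open import Data.Fin.Subset using (Subset; _⊆_; _⊂_; ∣_∣) renaming (_∈_ to _∈ˢ_; ⊤ to ⊤ˢ)
open import Data.Fin.Subset.Properties using (p⊆q⇒∣p∣≤∣q∣; p⊂q⇒∣p∣<∣q∣; ∣⊤∣≡n) renaming (∈⊤ to ∈⊤ˢ)
open import Data.Vec using (Vec; []; _∷_; lookup; tabulate)
open import Data.Vec.Properties using (∷-injectiveʳ; lookup∘tabulate; tabulate∘lookup; tabulate-cong; []=⇒lookup; lookup⇒[]=)
open import Data.List using (List; []; _∷_; _++_; length)
import Data.List as List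
open import Data.List.Properties using (length-map; length-++)
open import Data.List.Membership.Propositional using (_∈_)
open import Data.List.Membership.Propositional.Properties using (∈-map⁺; ∈-map⁻; ∈-++⁺ˡ; ∈-++⁺ʳ; ∈-++⁻; ∈-lookup)
open import Data.List.Relation.Unary.Any using (here; index)
open import Data.List.Relation.Unary.Any.Properties using (lookup-index)
import Data.List.Relation.Unary.All as All
open import Data.List.Relation.Unary.AllPairs using ([]; _∷_)
open import Data.List.Relation.Unary.Unique.Propositional using (Unique)
import Data.List.Relation.Unary.Unique.Propositional.Properties as Unique
open import Data.Product using (_×_; _,_; proj₁; proj₂; ∃)
open import Data.Product.Properties using (≡-dec)
open import Data.Sum using (_⊎_; inj₁; inj₂; [_,_]′)
import Data.Sum as Sum
open import Data.Unit using (⊤; tt)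
open import Data.Empty using (⊥; ⊥-elim)
open import Function using (_∘_)
open import Function.Bundles using (_⇔_; _↔_; mk⇔; mk↔ₛ′; Equivalence; Inverse; Injection)
open import Function.Definitions using (Injective)
open import Function.Properties.Inverse using (↔-refl; ↔-sym; ↔-trans; ↔⇒↣)
import Function.Properties.Equivalence as ⇔
open import Level using (0ℓ)
open import Relation.Binary using (Decidable; IsStrictTotalOrder; Trichotomous; tri<; tri≈; tri>)
open import Relation.Binary.PropositionalEquality
open import Relation.Nullary using (¬_; Dec; yes; no; does)
open import Relation.Nullary.Decidable using (dec-true; map′; isYes; toWitness; fromWitness; _×-dec_; ¬?)
import Relation.Unary as U

-- Binomial identities and ballot numbers

[m+k]Cm≡[m+k]Ck : ∀ m k → (m + k) C m ≡ (m + k) C k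
[m+k]Cm≡[m+k]Ck m k = trans (nCk≡nC[n∸k] (m≤m+n m k)) (cong ((m + k) C_) (m+n∸m≡n m k))

[1+k]*[1+n]C[1+k]≡[1+n]*nCk : ∀ n k → suc k * (suc n C suc k) ≡ suc n * (n C k)
[1+k]*[1+n]C[1+k]≡[1+n]*nCk zero zero = refl
[1+k]*[1+n]C[1+k]≡[1+n]*nCk zero (suc k) = begin
  suc (suc k) * (1 C suc (suc k))  ≡⟨ cong (suc (suc k) *_) (k>n⇒nCk≡0 {1} {suc (suc k)} (s≤s (s≤s z≤n))) ⟩
  suc (suc k) * 0                  ≡⟨ *-zeroʳ (suc (suc k)) ⟩
  0                                ≡⟨ cong (1 *_) (k>n⇒nCk≡0 {0} {suc k} (s≤s z≤n)) ⟨
  1 * (0 C suc k)                  ∎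
  where open ≡-Reasoning
[1+k]*[1+n]C[1+k]≡[1+n]*nCk (suc n) zero =
  trans (+-identityʳ _) (trans (nC1≡n (suc (suc n))) (sym (*-identityʳ (suc (suc n)))))
[1+k]*[1+n]C[1+k]≡[1+n]*nCk (suc n) (suc k) = begin
  suc (suc k) * (suc (suc n) C suc (suc k))
    ≡⟨ cong (suc (suc k) *_) (nCk+nC[k+1]≡[n+1]C[k+1] (suc n) (suc k)) ⟨
  suc (suc k) * (a + b)
    ≡⟨ *-distribˡ-+ (suc (suc k)) a b ⟩
  (a + suc k * a) + suc (suc k) * b
    ≡⟨ cong₂ (λ u v → a + u + v) ([1+k]*[1+n]C[1+k]≡[1+n]*nCk n k) ([1+k]*[1+n]C[1+k]≡[1+n]*nCk n (suc k)) ⟩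
  (a + suc n * (n C k)) + suc n * (n C suc k)
    ≡⟨ +-assoc a _ _ ⟩
  a + (suc n * (n C k) + suc n * (n C suc k))
    ≡⟨ cong (a +_) (*-distribˡ-+ (suc n) (n C k) (n C suc k)) ⟨
  a + suc n * (n C k + n C suc k)
    ≡⟨ cong (λ u → a + suc n * u) (nCk+nC[k+1]≡[n+1]C[k+1] n k) ⟩
  suc (suc n) * a ∎
  where
  open ≡-Reasoning
  a b : ℕ
  a = suc n C suc k
  b = suc n C suc (suc k)

[1+n]*2nC[1+n]≡n*2nCn : ∀ n → suc n * ((n + n) C suc n) ≡ n * ((n + n) C n)
[1+n]*2nC[1+n]≡n*2nCn zero = refl
[1+n]*2nC[1+n]≡n*2nCn (suc p) = begin
  suc (suc p) * ((suc p + suc p) C suc (suc p))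
    ≡⟨ cong (λ t → suc (suc p) * (t C suc (suc p))) 2[1+p]≡2+2p ⟩
  suc (suc p) * (suc (suc (p + p)) C suc (suc p))
    ≡⟨ [1+k]*[1+n]C[1+k]≡[1+n]*nCk (suc (p + p)) (suc p) ⟩
  suc (suc (p + p)) * (suc (p + p) C suc p)
    ≡⟨ cong (λ t → suc (suc (p + p)) * (t C suc p)) (+-suc p p) ⟨
  suc (suc (p + p)) * ((p + suc p) C suc p)
    ≡⟨ cong (suc (suc (p + p)) *_) ([m+k]Cm≡[m+k]Ck p (suc p)) ⟨
  suc (suc (p + p)) * ((p + suc p) C p)
    ≡⟨ cong (λ t → suc (suc (p + p)) * (t C p)) (+-suc p p) ⟩
  suc (suc (p + p)) * (suc (p + p) C p)
    ≡⟨ [1+k]*[1+n]C[1+k]≡[1+n]*nCk (suc (p + p)) p ⟨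
  suc p * (suc (suc (p + p)) C suc p)
    ≡⟨ cong (λ t → suc p * (t C suc p)) 2[1+p]≡2+2p ⟨
  suc p * ((suc p + suc p) C suc p) ∎
  where
  open ≡-Reasoning
  2[1+p]≡2+2p : suc p + suc p ≡ suc (suc (p + p))
  2[1+p]≡2+2p = cong suc (+-suc p p)

ballotNumber : ℕ → ℕ → ℕ
ballotNumber zero    s       = 1
ballotNumber (suc m) zero    = ballotNumber m 1
ballotNumber (suc m) (suc s) = ballotNumber m (suc (suc s)) + ballotNumber (suc m) s

pascal-step : ∀ K b x y → x + K C suc (suc b) ≡ K C suc b → y + K C suc b ≡ K C b →
              (x + y) + suc K C suc (suc b) ≡ suc K C suc b
pascal-step K b x y hx hy = begin
  (x + y) + suc K C suc (suc b)          ≡⟨ cong ((x + y) +_) (nCk+nC[k+1]≡[n+1]C[k+1] K (suc b)) ⟨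
  (x + y) + (K C suc b + K C suc (suc b)) ≡⟨ +-assoc x y _ ⟩
  x + (y + (K C suc b + K C suc (suc b))) ≡⟨ cong (x +_) (+-assoc y _ _) ⟨
  x + ((y + K C suc b) + K C suc (suc b)) ≡⟨ cong (λ t → x + (t + K C suc (suc b))) hy ⟩
  x + (K C b + K C suc (suc b))          ≡⟨ cong (x +_) (+-comm (K C b) _) ⟩
  x + (K C suc (suc b) + K C b)          ≡⟨ +-assoc x _ _ ⟨
  (x + K C suc (suc b)) + K C b          ≡⟨ cong (_+ K C b) hx ⟩
  K C suc b + K C b                      ≡⟨ +-comm (K C suc b) _ ⟩
  K C b + K C suc b                      ≡⟨ nCk+nC[k+1]≡[n+1]C[k+1] K b ⟩
  suc K C suc b                          ∎
  where open ≡-Reasoning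

-- ballotNumber m s = C(2m+s, m+s) - C(2m+s, m+s+1), stated without truncated subtraction.
ballotNumber-closed : ∀ m s → ballotNumber m s + (m + (m + s)) C suc (m + s) ≡ (m + (m + s)) C (m + s)
ballotNumber-closed zero s = trans (cong suc (k>n⇒nCk≡0 {s} {suc s} ≤-refl)) (sym (nCn≡1 s))
ballotNumber-closed (suc m) zero =
  subst (λ a → x + (suc m + a) C suc a ≡ (suc m + a) C a) (sym (+-identityʳ (suc m)))
    (subst (λ t → t + suc K C suc (suc m) ≡ suc K C suc m) (+-identityʳ x)
      (pascal-step K m x 0
        (subst (λ a → x + (m + a) C suc a ≡ (m + a) C a) (+-comm m 1) (ballotNumber-closed m 1))
        (sym ([m+k]Cm≡[m+k]Ck m (suc m)))))
  where
  x K : ℕ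
  x = ballotNumber m 1
  K = m + suc m
ballotNumber-closed (suc m) (suc s) =
  subst (λ a → x + y + (suc m + a) C suc a ≡ (suc m + a) C a) (sym (cong suc (+-suc m s)))
    (pascal-step (m + suc b) b x y
      (subst (λ a → x + (m + a) C suc a ≡ (m + a) C a) (trans (+-suc m (suc s)) (cong suc (+-suc m s)))
        (ballotNumber-closed m (suc (suc s))))
      (subst (λ K → y + K C suc b ≡ K C b) (sym (+-suc m b)) (ballotNumber-closed (suc m) s)))
  where
  x y b : ℕ
  x = ballotNumber m (suc (suc s))
  y = ballotNumber (suc m) s
  b = suc m + s

[1+n]*ballotNumber≡2nCn : ∀ n → suc n * ballotNumber n 0 ≡ (n + n) C n
[1+n]*ballotNumber≡2nCn n = +-cancelʳ-≡ (n * B) _ _ (begin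
  suc n * c + n * B     ≡⟨ cong (suc n * c +_) ([1+n]*2nC[1+n]≡n*2nCn n) ⟨
  suc n * c + suc n * A ≡⟨ *-distribˡ-+ (suc n) c A ⟨
  suc n * (c + A)       ≡⟨ cong (suc n *_) closed ⟩
  B + n * B             ∎)
  where
  open ≡-Reasoning
  c A B : ℕ
  c = ballotNumber n 0
  A = (n + n) C suc n
  B = (n + n) C n
  closed : c + A ≡ B
  closed = subst (λ k → c + (n + k) C suc k ≡ (n + k) C k) (+-identityʳ n) (ballotNumber-closed n 0)

catalan≡ballotNumber : ∀ n → catalan n ≡ ballotNumber n 0
catalan≡ballotNumber n = begin
  ((n + n) C n) / suc n             ≡⟨ cong (_/ suc n) ([1+n]*ballotNumber≡2nCn n) ⟨
  (suc n * ballotNumber n 0) / suc n ≡⟨ cong (_/ suc n) (*-comm (suc n) (ballotNumber n 0)) ⟩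
  (ballotNumber n 0 * suc n) / suc n ≡⟨ m*n/n≡m (ballotNumber n 0) (suc n) ⟩
  ballotNumber n 0                   ∎
  where open ≡-Reasoning

-- Ballot c lo xs : xs is weakly increasing, bounded below by lo, and its i-th entry is at most c + i.
Ballot : ∀ {m} → ℕ → ℕ → Vec ℕ m → Set
Ballot c lo []       = ⊤
Ballot c lo (x ∷ xs) = lo ≤ x × x ≤ c × Ballot (suc c) x xs

Ballot-weaken : ∀ {m c lo lo'} (xs : Vec ℕ m) → lo ≤ lo' → Ballot c lo' xs → Ballot c lo xs
Ballot-weaken []      _      _             = tt
Ballot-weaken (_ ∷ _) lo≤lo' (lo'≤x , rest) = ≤-trans lo≤lo' lo'≤x , rest

ballots : ∀ m → ℕ → ℕ → List (Vec ℕ m)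
ballots zero    lo s       = [] ∷ []
ballots (suc m) lo zero    = List.map (lo ∷_) (ballots m lo 1)
ballots (suc m) lo (suc s) = List.map (lo ∷_) (ballots m lo (suc (suc s))) ++ ballots (suc m) (suc lo) s

ballots-sound : ∀ m lo s {xs} → xs ∈ ballots m lo s → Ballot (lo + s) lo xs
ballots-sound zero lo s (here refl) = tt
ballots-sound (suc m) lo zero xs∈ with ∈-map⁻ (lo ∷_) xs∈
... | ys , ys∈ , refl =
  ≤-refl , m≤m+n lo 0 , subst (λ c → Ballot c lo ys) (+-suc lo 0) (ballots-sound m lo 1 ys∈)
ballots-sound (suc m) lo (suc s) xs∈ with ∈-++⁻ (List.map (lo ∷_) (ballots m lo (suc (suc s)))) xs∈
... | inj₁ xs∈ˡ with ∈-map⁻ (lo ∷_) xs∈ˡ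
...   | ys , ys∈ , refl =
  ≤-refl , m≤m+n lo (suc s) , subst (λ c → Ballot c lo ys) (+-suc lo (suc s)) (ballots-sound m lo (suc (suc s)) ys∈)
ballots-sound (suc m) lo (suc s) {xs} xs∈ | inj₂ xs∈ʳ =
  Ballot-weaken xs (n≤1+n lo)
    (subst (λ c → Ballot c (suc lo) xs) (sym (+-suc lo s)) (ballots-sound (suc m) (suc lo) s xs∈ʳ))

ballots-complete : ∀ {m} lo s (xs : Vec ℕ m) → Ballot (lo + s) lo xs → xs ∈ ballots m lo s
ballots-complete _  _ []             _                      = here refl
ballots-complete lo s (_∷_ {m} x xs) (lo≤x , x≤lo+s , bxs) = cons∈ lo s lo≤x x≤lo+s bxs
  where
  cons∈ : ∀ lo s → lo ≤ x → x ≤ lo + s → Ballot (suc (lo + s)) x xs → (x ∷ xs) ∈ ballots (suc m) lo s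
  cons∈ lo s lo≤x x≤lo+s bxs with m≤n⇒m<n∨m≡n lo≤x
  cons∈ lo zero    _ _ bxs | inj₂ refl =
    ∈-map⁺ (x ∷_) (ballots-complete x 1 xs (subst (λ c → Ballot c x xs) (sym (+-suc x 0)) bxs))
  cons∈ lo (suc s) _ _ bxs | inj₂ refl =
    ∈-++⁺ˡ (∈-map⁺ (x ∷_)
      (ballots-complete x (suc (suc s)) xs (subst (λ c → Ballot c x xs) (sym (+-suc x (suc s))) bxs)))
  cons∈ lo zero    _ x≤lo+0 _   | inj₁ lo<x = ⊥-elim (<⇒≱ lo<x (subst (x ≤_) (+-identityʳ lo) x≤lo+0))
  cons∈ lo (suc s) _ x≤lo+s bxs | inj₁ lo<x =
    ∈-++⁺ʳ (List.map (lo ∷_) (ballots m lo (suc (suc s))))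
      (cons∈ (suc lo) s lo<x (subst (x ≤_) (+-suc lo s) x≤lo+s) (subst (λ c → Ballot (suc c) x xs) (+-suc lo s) bxs))

ballots-unique : ∀ m lo s → Unique (ballots m lo s)
ballots-unique zero    lo s       = All.[] ∷ []
ballots-unique (suc m) lo zero    = Unique.map⁺ ∷-injectiveʳ (ballots-unique m lo 1)
ballots-unique (suc m) lo (suc s) =
  Unique.++⁺ (Unique.map⁺ ∷-injectiveʳ (ballots-unique m lo (suc (suc s)))) (ballots-unique (suc m) (suc lo) s) disjoint
  where
  disjoint : ∀ {v} → ¬ (v ∈ List.map (lo ∷_) (ballots m lo (suc (suc s))) × v ∈ ballots (suc m) (suc lo) s)
  disjoint (v∈ˡ , v∈ʳ) with ∈-map⁻ (lo ∷_) v∈ˡ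
  ... | _ , _ , refl = 1+n≰n (proj₁ (ballots-sound (suc m) (suc lo) s v∈ʳ))

length-ballots : ∀ m lo s → length (ballots m lo s) ≡ ballotNumber m s
length-ballots zero    lo s       = refl
length-ballots (suc m) lo zero    = trans (length-map (lo ∷_) (ballots m lo 1)) (length-ballots m lo 1)
length-ballots (suc m) lo (suc s) = begin
  length (List.map (lo ∷_) (ballots m lo (suc (suc s))) ++ ballots (suc m) (suc lo) s)
    ≡⟨ length-++ (List.map (lo ∷_) (ballots m lo (suc (suc s)))) ⟩
  length (List.map (lo ∷_) (ballots m lo (suc (suc s)))) + length (ballots (suc m) (suc lo) s)
    ≡⟨ cong₂ _+_ (trans (length-map (lo ∷_) (ballots m lo (suc (suc s)))) (length-ballots m lo (suc (suc s))))
                 (length-ballots (suc m) (suc lo) s) ⟩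
  ballotNumber m (suc (suc s)) + ballotNumber (suc m) s ∎
  where open ≡-Reasoning

module _ {n : ℕ} {T R T' R' : Rel n} where

  ⇔⇒Iso : (∀ x y → T x y ⇔ T' x y) → (∀ x y → R x y ⇔ R' x y) → Iso T R T' R'
  ⇔⇒Iso T⇔T' R⇔R' = ↔-refl , λ x y → T⇔T' x y , R⇔R' x y

  Iso-sym : Iso T R T' R' → Iso T' R' T R
  Iso-sym (φ , pres) = ↔-sym φ , λ x y →
    subst₂ (λ a b → T' a b ⇔ T (from x) (from y)) (to∘from x) (to∘from y) (⇔.sym (proj₁ (pres (from x) (from y)))) ,
    subst₂ (λ a b → R' a b ⇔ R (from x) (from y)) (to∘from x) (to∘from y) (⇔.sym (proj₂ (pres (from x) (from y))))
    where open Inverse φ using (to; from) renaming (strictlyInverseˡ to to∘from)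

  IsCatalanPair2-pullback : Iso T R T' R' → IsCatalanPair2 T' R' → IsCatalanPair2 T R
  IsCatalanPair2-pullback (φ , pres) ((R-irr , R-tr) , (L-irr , L-tr) , comp , c2c₁ , c2c₂) =
    ((λ x → R-irr (f x) ∘ Rto) , λ _ _ _ p q → Rfrom (R-tr _ _ _ (Rto p) (Rto q))) ,
    ((λ x → L-irr (f x) ∘ Lto) , λ _ _ _ p q → Lfrom (L-tr _ _ _ (Lto p) (Lto q))) ,
    (λ x y x≢y →
       [ inj₁ ∘ Sum.map Tfrom Tfrom , inj₂ ∘ Sum.map Rfrom Rfrom ]′ (proj₁ (comp (f x) (f y) (f-inj x≢y))) ,
       λ (c , d) → proj₂ (comp (f x) (f y) (f-inj x≢y)) (Sum.map Tto Tto c , Sum.map Rto Rto d)) ,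
    (λ _ _ _ (x≢y , x≢z , y≢z) (p , q , r) → c2c₁ _ _ _ (f-inj x≢y , f-inj x≢z , f-inj y≢z) (Tto p , Tto q , Rto r)) ,
    (λ _ _ _ (x≢y , x≢z , y≢z) (p , q , r) → c2c₂ _ _ _ (f-inj x≢y , f-inj x≢z , f-inj y≢z) (Tto p , Tto q , Rto r))
    where
    f : Fin n → Fin n
    f = Inverse.to φ
    f-inj : ∀ {x y} → x ≢ y → f x ≢ f y
    f-inj x≢y = x≢y ∘ Injection.injective (↔⇒↣ φ)
    Tto : ∀ {x y} → T x y → T' (f x) (f y)
    Tto = Equivalence.to (proj₁ (pres _ _))
    Tfrom : ∀ {x y} → T' (f x) (f y) → T x y
    Tfrom = Equivalence.from (proj₁ (pres _ _))
    Rto : ∀ {x y} → R x y → R' (f x) (f y)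
    Rto = Equivalence.to (proj₂ (pres _ _))
    Rfrom : ∀ {x y} → R' (f x) (f y) → R x y
    Rfrom = Equivalence.from (proj₂ (pres _ _))
    Lto : ∀ {x y} → (T ∪ R) x y → (T' ∪ R') (f x) (f y)
    Lto = Sum.map Tto Rto
    Lfrom : ∀ {x y} → (T' ∪ R') (f x) (f y) → (T ∪ R) x y
    Lfrom = Sum.map Tfrom Rfrom

-- Iso unfolds to a Σ-type in which the relations occur only applied to Inverse.to φ, so
-- the structures in a use of Iso-trans cannot be inferred and are passed by name.
Iso-trans : ∀ {n} {T R T' R' T'' R'' : Rel n} → Iso T R T' R' → Iso T' R' T'' R'' → Iso T R T'' R''
Iso-trans (φ , p) (ψ , q) = ↔-trans φ ψ , λ x y →
  ⇔.trans (proj₁ (p x y)) (proj₁ (q _ _)) , ⇔.trans (proj₂ (p x y)) (proj₂ (q _ _))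

module _ {n : ℕ} {P : U.Pred (Fin n) 0ℓ} (P? : U.Decidable P) where

  subset : Subset n
  subset = tabulate (does ∘ P?)

  ∈-subset⁺ : ∀ {x} → P x → x ∈ˢ subset
  ∈-subset⁺ {x} px = lookup⇒[]= x subset (trans (lookup∘tabulate (does ∘ P?) x) (dec-true (P? x) px))

  ∈-subset⁻ : ∀ {x} → x ∈ˢ subset → P x
  ∈-subset⁻ {x} x∈ with P? x | trans (sym (lookup∘tabulate (does ∘ P?) x)) ([]=⇒lookup x∈)
  ... | yes px | _ = px
  ... | no _   | ()

injective⇒onto : ∀ {n} (f : Fin n → Fin n) → Injective _≡_ _≡_ f → ∀ y → ∃ λ x → f x ≡ y
injective⇒onto f f-inj y with any? (λ x → f x ≟ᶠ y)
... | yes hit = hit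
injective⇒onto {suc m} f f-inj y | no miss
  with pigeonhole (n<1+n m) (λ x → punchOut (λ fx≡y → miss (x , sym fx≡y)))
... | i , j , i<j , eq =
  ⊥-elim (Finₚ.<-irrefl (f-inj (punchOut-injective {i = y} (λ e → miss (i , sym e)) (λ e → miss (j , sym e)) eq)) i<j)

injective⇒↔ : ∀ {n} (f : Fin n → Fin n) → Injective _≡_ _≡_ f → Fin n ↔ Fin n
injective⇒↔ f f-inj =
  mk↔ₛ′ f (proj₁ ∘ onto) (proj₂ ∘ onto) (λ x → f-inj (proj₂ (onto (f x))))
  where
  onto : ∀ y → ∃ λ x → f x ≡ y
  onto = injective⇒onto f f-inj

strictlyMonotone⇒≤ : ∀ {n} (f : Fin n → Fin n) → (∀ {i j} → i <ᶠ j → f i <ᶠ f j) → ∀ i → i ≤ᶠ f i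
strictlyMonotone⇒≤ {suc n} f mono = <-weakInduction (λ i → i ≤ᶠ f i) z≤n step
  where
  step : ∀ i → inject₁ i ≤ᶠ f (inject₁ i) → suc i ≤ᶠ f (suc i)
  step i ih = ≤-<-trans (subst (_≤ toℕ (f (inject₁ i))) (Finₚ.toℕ-inject₁ i) ih)
                        (mono (s≤s (≤-reflexive (Finₚ.toℕ-inject₁ i))))

strictlyMonotone-↔⇒id : ∀ {n} (φ : Fin n ↔ Fin n) → let open Inverse φ in
                        (∀ {i j} → i <ᶠ j → to i <ᶠ to j) → ∀ i → to i ≡ i
strictlyMonotone-↔⇒id φ mono i =
  Finₚ.≤-antisym (subst (to i ≤ᶠ_) (strictlyInverseʳ i) (strictlyMonotone⇒≤ from from-mono (to i)))
                (strictlyMonotone⇒≤ to mono i)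
  where
  open Inverse φ
  from-mono : ∀ {i j} → i <ᶠ j → from i <ᶠ from j
  from-mono {i} {j} i<j with Finₚ.<-cmp (from i) (from j)
  ... | tri< lt _ _ = lt
  ... | tri≈ _ eq _ = ⊥-elim (Finₚ.<-irrefl (trans (sym (strictlyInverseˡ i)) (trans (cong to eq) (strictlyInverseˡ j))) i<j)
  ... | tri> _ _ gt = ⊥-elim (Finₚ.<-asym i<j (subst₂ _<ᶠ_ (strictlyInverseˡ j) (strictlyInverseˡ i) (mono gt)))

module Rank {n : ℕ} {L : Rel n} (L-sto : IsStrictTotalOrder _≡_ L) where
  open IsStrictTotalOrder L-sto using (compare; irrefl) renaming (trans to L-trans; _<?_ to _L?_)

  below? : ∀ x → U.Decidable (λ y → L y x)
  below? x y = y L? x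

  rank : Fin n → ℕ
  rank x = ∣ subset (below? x) ∣

  DownClosed : U.Pred (Fin n) 0ℓ → Set
  DownClosed D = ∀ {a b} → L b a → D a → D b

  ∈-downClosed⇔rank< : ∀ {D} (D? : U.Decidable D) → DownClosed D → ∀ x → D x ⇔ rank x < ∣ subset D? ∣
  ∈-downClosed⇔rank< {D} D? closed x = mk⇔ (p⊂q⇒∣p∣<∣q∣ ∘ below⊂D) in-D
    where
    below⊂D : D x → subset (below? x) ⊂ subset D?
    below⊂D dx = (λ y∈ → ∈-subset⁺ D? (closed (∈-subset⁻ (below? x) y∈) dx)) ,
                 x , ∈-subset⁺ D? dx , irrefl refl ∘ ∈-subset⁻ (below? x)
    D⊆below : ¬ D x → subset D? ⊆ subset (below? x)
    D⊆below ¬dx {y} y∈ with compare y x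
    ... | tri< y<x _ _ = ∈-subset⁺ (below? x) y<x
    ... | tri≈ _ refl _ = ⊥-elim (¬dx (∈-subset⁻ D? y∈))
    ... | tri> _ _ x<y = ⊥-elim (¬dx (closed x<y (∈-subset⁻ D? y∈)))
    in-D : rank x < ∣ subset D? ∣ → D x
    in-D lt with D? x
    ... | yes dx = dx
    ... | no ¬dx = ⊥-elim (<⇒≱ lt (p⊆q⇒∣p∣≤∣q∣ (D⊆below ¬dx)))

  rank-mono : ∀ {x y} → L x y → rank x < rank y
  rank-mono {x} {y} x<y = Equivalence.to (∈-downClosed⇔rank< (below? y) (λ b<a a<y → L-trans b<a a<y) x) x<y

  rank<n : ∀ x → rank x < n
  rank<n x = <-≤-trans (p⊂q⇒∣p∣<∣q∣ below⊂⊤) (≤-reflexive (∣⊤∣≡n n))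
    where
    below⊂⊤ : subset (below? x) ⊂ ⊤ˢ
    below⊂⊤ = (λ _ → ∈⊤ˢ) , x , ∈⊤ˢ , irrefl refl ∘ ∈-subset⁻ (below? x)

  rank-reflects : ∀ {x y} → rank x < rank y → L x y
  rank-reflects {x} {y} lt with compare x y
  ... | tri< x<y _ _ = x<y
  ... | tri≈ _ refl _ = ⊥-elim (<-irrefl refl lt)
  ... | tri> _ _ y<x = ⊥-elim (<-asym lt (rank-mono y<x))

  rank-injective : ∀ {x y} → rank x ≡ rank y → x ≡ y
  rank-injective {x} {y} eq with compare x y
  ... | tri< x<y _ _ = ⊥-elim (<-irrefl eq (rank-mono x<y))
  ... | tri≈ _ x≡y _ = x≡y
  ... | tri> _ _ y<x = ⊥-elim (<-irrefl (sym eq) (rank-mono y<x))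

  position : Fin n → Fin n
  position x = fromℕ< (rank<n x)

  toℕ-position : ∀ x → toℕ (position x) ≡ rank x
  toℕ-position x = toℕ-fromℕ< (rank<n x)

  position↔ : Fin n ↔ Fin n
  position↔ = injective⇒↔ position λ {x} {y} eq →
    rank-injective (trans (sym (toℕ-position x)) (trans (cong toℕ eq) (toℕ-position y)))


-- The pair on Fin n in which T ∪ R is the natural order and j has exactly the
-- R-predecessors 0, …, g j - 1.
module _ {n : ℕ} (g : Fin n → ℕ) where

  CanonR : Rel n
  CanonR i j = toℕ i < g j

  CanonT : Rel n
  CanonT i j = toℕ i < toℕ j × ¬ CanonR i j

record IsProfile {n : ℕ} (g : Fin n → ℕ) : Set where
  field
    bounded  : ∀ j → g j ≤ toℕ j
    monotone : ∀ {i j} → toℕ i ≤ toℕ j → g i ≤ g j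

module _ {n : ℕ} {g : Fin n → ℕ} (g-profile : IsProfile g) where
  open IsProfile g-profile

  CanonR⇒< : ∀ {i j} → CanonR g i j → toℕ i < toℕ j
  CanonR⇒< {i} {j} r = <-≤-trans r (bounded j)

  Canon∪⇔< : ∀ i j → (CanonT g ∪ CanonR g) i j ⇔ toℕ i < toℕ j
  Canon∪⇔< i j = mk⇔ (λ { (inj₁ t) → proj₁ t ; (inj₂ r) → CanonR⇒< r }) from
    where
    from : toℕ i < toℕ j → (CanonT g ∪ CanonR g) i j
    from i<j with toℕ i <? g j
    ... | yes r = inj₂ r
    ... | no ¬r = inj₁ (i<j , ¬r)

  canonical-isCatalanPair2 : IsCatalanPair2 (CanonT g) (CanonR g)
  canonical-isCatalanPair2 =
    ((λ _ r → <-irrefl refl (CanonR⇒< r)) , (λ _ _ _ r r' → <-trans (CanonR⇒< r) r')) ,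
    ((λ _ l → <-irrefl refl (to∪ l)) , (λ _ _ _ l l' → from∪ (<-trans (to∪ l) (to∪ l')))) ,
    (λ i j i≢j → comparable i j i≢j , exclusive) ,
    (λ _ _ _ _ ((i<j , _) , (_ , i≮gk) , j<gk) → i≮gk (<-trans i<j j<gk)) ,
    (λ _ _ _ _ ((_ , j≮gi) , (k<i , _) , j<gk) → j≮gi (<-≤-trans j<gk (monotone (<⇒≤ k<i))))
    where
    to∪ : ∀ {i j} → (CanonT g ∪ CanonR g) i j → toℕ i < toℕ j
    to∪ = Equivalence.to (Canon∪⇔< _ _)
    from∪ : ∀ {i j} → toℕ i < toℕ j → (CanonT g ∪ CanonR g) i j
    from∪ = Equivalence.from (Canon∪⇔< _ _)
    comparable : ∀ i j → i ≢ j → Comparable (CanonT g) i j ⊎ Comparable (CanonR g) i j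
    comparable i j i≢j with <-cmp (toℕ i) (toℕ j)
    ... | tri≈ _ eq _ = ⊥-elim (i≢j (toℕ-injective eq))
    ... | tri< i<j _ _ = [ inj₁ ∘ inj₁ , inj₂ ∘ inj₁ ]′ (from∪ i<j)
    ... | tri> _ _ j<i = [ inj₁ ∘ inj₂ , inj₂ ∘ inj₂ ]′ (from∪ j<i)
    exclusive : ∀ {i j} → ¬ (Comparable (CanonT g) i j × Comparable (CanonR g) i j)
    exclusive (inj₁ (_ , ¬r) , inj₁ r) = ¬r r
    exclusive (inj₁ (i<j , _) , inj₂ r) = <-asym i<j (CanonR⇒< r)
    exclusive (inj₂ (j<i , _) , inj₁ r) = <-asym j<i (CanonR⇒< r)
    exclusive (inj₂ (_ , ¬r) , inj₂ r) = ¬r r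

canonical-cong : ∀ {n} {g g' : Fin n → ℕ} → (∀ j → g j ≡ g' j) → Iso (CanonT g) (CanonR g) (CanonT g') (CanonR g')
canonical-cong {g = g} g≗g' =
  ⇔⇒Iso (λ i j → subst (λ k → CanonT g i j ⇔ (toℕ i < toℕ j × ¬ toℕ i < k)) (g≗g' j) ⇔.refl)
        (λ i j → subst (λ k → CanonR g i j ⇔ toℕ i < k) (g≗g' j) ⇔.refl)

CanonR⊆⇒≤ : ∀ {n} {g g' : Fin n → ℕ} → IsProfile g → ∀ j →
            (∀ i → CanonR g i j → CanonR g' i j) → g j ≤ g' j
CanonR⊆⇒≤ {n} {g} {g'} g-profile j g⊆g' with g j ≤? g' j
... | yes gj≤g'j = gj≤g'j
... | no gj≰g'j  =
  ⊥-elim (<-irrefl (toℕ-fromℕ< g'j<n) (g⊆g' (fromℕ< g'j<n) (subst (_< g j) (sym (toℕ-fromℕ< g'j<n)) g'j<gj)))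
  where
  g'j<gj : g' j < g j
  g'j<gj = ≰⇒> gj≰g'j
  g'j<n : g' j < n
  g'j<n = <-≤-trans g'j<gj (≤-trans (IsProfile.bounded g-profile j) (<⇒≤ (toℕ<n j)))

module _ {n : ℕ} {g g' : Fin n → ℕ} (g-profile : IsProfile g) (g'-profile : IsProfile g') where

  canonical-Iso⇒≗ : Iso (CanonT g) (CanonR g) (CanonT g') (CanonR g') → ∀ j → g j ≡ g' j
  canonical-Iso⇒≗ (φ , pres) j =
    ≤-antisym (CanonR⊆⇒≤ {g' = g'} g-profile j R-to) (CanonR⊆⇒≤ {g' = g} g'-profile j R-from)
    where
    open Inverse φ using (to)
    mono : ∀ {i j} → toℕ i < toℕ j → toℕ (to i) < toℕ (to j)
    mono {i} {j} = Equivalence.to (Canon∪⇔< g'-profile (to i) (to j))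
                 ∘ Sum.map (Equivalence.to (proj₁ (pres i j))) (Equivalence.to (proj₂ (pres i j)))
                 ∘ Equivalence.from (Canon∪⇔< g-profile i j)
    to≡id : ∀ i → to i ≡ i
    to≡id = strictlyMonotone-↔⇒id φ mono
    R-to : ∀ i → CanonR g i j → CanonR g' i j
    R-to i r = subst₂ (CanonR g') (to≡id i) (to≡id j) (Equivalence.to (proj₂ (pres i j)) r)
    R-from : ∀ i → CanonR g' i j → CanonR g i j
    R-from i r = Equivalence.from (proj₂ (pres i j)) (subst₂ (CanonR g') (sym (to≡id i)) (sym (to≡id j)) r)

-- The structure of a Catalan pair

module _ {n : ℕ} {R : Rel n} (R? : Decidable R) where

  indegree : Fin n → ℕ
  indegree y = ∣ subset (λ a → R? a y) ∣

  atMost : ℕ → Subset n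
  atMost k = subset (λ y → indegree y ≤? k)

module CatalanPair {n : ℕ} {T R : Rel n} (cat : IsCatalanPair2 T R) where
  private
    R-irrefl = proj₁ (proj₁ cat)
    R-trans  = proj₂ (proj₁ cat)
    L-irrefl = proj₁ (proj₁ (proj₂ cat))
    L-trans  = proj₂ (proj₁ (proj₂ cat))
    C2b      = proj₁ (proj₂ (proj₂ cat))
    C2c₁     = proj₁ (proj₂ (proj₂ (proj₂ cat)))
    C2c₂     = proj₂ (proj₂ (proj₂ (proj₂ cat)))

  L : Rel n
  L = T ∪ R

  L-asym : ∀ {x y} → L x y → ¬ L y x
  L-asym {x} {y} p q = L-irrefl x (L-trans x y x p q)

  L-isStrictTotalOrder : IsStrictTotalOrder _≡_ L
  L-isStrictTotalOrder = record
    { isStrictPartialOrder = record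
      { isEquivalence = isEquivalence
      ; irrefl        = λ { refl → L-irrefl _ }
      ; trans         = λ p q → L-trans _ _ _ p q
      ; <-resp-≈      = (λ { refl p → p }) , (λ { refl p → p })
      }
    ; compare = compare
    }
    where
    compare : Trichotomous _≡_ L
    compare x y with x ≟ᶠ y
    ... | yes refl = tri≈ (L-irrefl x) refl (L-irrefl x)
    ... | no x≢y with proj₁ (C2b x y x≢y)
    ...   | inj₁ (inj₁ t) = tri< (inj₁ t) x≢y (L-asym (inj₁ t))
    ...   | inj₁ (inj₂ t) = tri> (L-asym (inj₁ t)) x≢y (inj₁ t)
    ...   | inj₂ (inj₁ r) = tri< (inj₂ r) x≢y (L-asym (inj₂ r))
    ...   | inj₂ (inj₂ r) = tri> (L-asym (inj₂ r)) x≢y (inj₂ r)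

  open Rank L-isStrictTotalOrder public

  L⇒≢ : ∀ {x y} → L x y → x ≢ y
  L⇒≢ {x} p refl = L-irrefl x p

  T⇒¬R : ∀ {x y} → T x y → ¬ R x y
  T⇒¬R t r = proj₂ (C2b _ _ (L⇒≢ (inj₁ t))) (inj₁ t , inj₁ r)

  R-downClosed : ∀ {a b y} → L b a → R a y → R b y
  R-downClosed (inj₂ rba) ray = R-trans _ _ _ rba ray
  R-downClosed {a} {b} {y} (inj₁ tba) ray with L-trans b a y (inj₁ tba) (inj₂ ray)
  ... | inj₂ rby = rby
  ... | inj₁ tby = ⊥-elim (C2c₁ b a y (L⇒≢ (inj₁ tba) , L⇒≢ (inj₁ tby) , L⇒≢ (inj₂ ray)) (tba , tby , ray))

  R-upClosed : ∀ {a x y} → L x y → R a x → R a y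
  R-upClosed (inj₂ rxy) rax = R-trans _ _ _ rax rxy
  R-upClosed {a} {x} {y} (inj₁ txy) rax with L-trans a x y (inj₂ rax) (inj₁ txy)
  ... | inj₂ ray = ray
  ... | inj₁ tay =
    ⊥-elim (C2c₂ y a x (L⇒≢ (inj₁ tay) ∘ sym , L⇒≢ (inj₁ txy) ∘ sym , L⇒≢ (inj₂ rax)) (tay , txy , rax))

  module _ (R? : Decidable R) where

    R⇔rank<indegree : ∀ x y → R x y ⇔ rank x < indegree R? y
    R⇔rank<indegree x y = ∈-downClosed⇔rank< (λ a → R? a y) R-downClosed x

    indegree-mono : ∀ {x y} → L x y → indegree R? x ≤ indegree R? y
    indegree-mono {x} {y} l =
      p⊆q⇒∣p∣≤∣q∣ (∈-subset⁺ (λ a → R? a y) ∘ R-upClosed l ∘ ∈-subset⁻ (λ a → R? a x))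

    indegree≤rank : ∀ y → indegree R? y ≤ rank y
    indegree≤rank y = p⊆q⇒∣p∣≤∣q∣ (∈-subset⁺ (below? y) ∘ inj₂ ∘ ∈-subset⁻ (λ a → R? a y))

    indegree≤⇔rank< : ∀ k y → indegree R? y ≤ k ⇔ rank y < ∣ atMost R? k ∣
    indegree≤⇔rank< k = ∈-downClosed⇔rank< (λ y → indegree R? y ≤? k) (λ l d → ≤-trans (indegree-mono l) d)

    T⇔ : ∀ x y → T x y ⇔ (rank x < rank y × ¬ rank x < indegree R? y)
    T⇔ x y = mk⇔ (λ t → rank-mono (inj₁ t) , T⇒¬R t ∘ Equivalence.from (R⇔rank<indegree x y)) from
      where
      from : rank x < rank y × ¬ rank x < indegree R? y → T x y
      from (lt , ¬lt) with rank-reflects lt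
      ... | inj₁ t = t
      ... | inj₂ r = ⊥-elim (¬lt (Equivalence.to (R⇔rank<indegree x y) r))

    unposition : Fin n → Fin n
    unposition = Inverse.from position↔

    rank-unposition : ∀ j → rank (unposition j) ≡ toℕ j
    rank-unposition j = trans (sym (toℕ-position (unposition j))) (cong toℕ (Inverse.strictlyInverseˡ position↔ j))

    profile : Fin n → ℕ
    profile j = indegree R? (unposition j)

    profile-position : ∀ x → profile (position x) ≡ indegree R? x
    profile-position x = cong (indegree R?) (Inverse.strictlyInverseʳ position↔ x)

    profile-isProfile : IsProfile profile
    profile-isProfile = record
      { bounded  = λ j → ≤-trans (indegree≤rank (unposition j)) (≤-reflexive (rank-unposition j))
      ; monotone = monotone
      }
      where
      monotone : ∀ {i j} → toℕ i ≤ toℕ j → profile i ≤ profile j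
      monotone {i} {j} i≤j with m≤n⇒m<n∨m≡n (subst₂ _≤_ (sym (rank-unposition i)) (sym (rank-unposition j)) i≤j)
      ... | inj₁ lt = indegree-mono (rank-reflects lt)
      ... | inj₂ eq = ≤-reflexive (cong (indegree R?) (rank-injective eq))

    profile≤⇔ : ∀ k j → profile j ≤ k ⇔ toℕ j < ∣ atMost R? k ∣
    profile≤⇔ k j =
      subst (λ r → profile j ≤ k ⇔ r < ∣ atMost R? k ∣) (rank-unposition j) (indegree≤⇔rank< k (unposition j))

    Iso-canonical : Iso T R (CanonT profile) (CanonR profile)
    Iso-canonical = position↔ , λ x y →
      subst (T x y ⇔_) (sym (canonT-position x y)) (T⇔ x y) ,
      subst (R x y ⇔_) (sym (canonR-position x y)) (R⇔rank<indegree x y)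
      where
      canonR-position : ∀ x y → CanonR profile (position x) (position y) ≡ (rank x < indegree R? y)
      canonR-position x y = cong₂ _<_ (toℕ-position x) (profile-position y)
      canonT-position : ∀ x y → CanonT profile (position x) (position y) ≡ (rank x < rank y × ¬ rank x < indegree R? y)
      canonT-position x y = cong₂ (λ a b → a × ¬ b) (cong₂ _<_ (toℕ-position x) (toℕ-position y)) (canonR-position x y)

Iso-sameR : ∀ {n} {T T' R : Rel n} → Decidable R → IsCatalanPair2 T R → IsCatalanPair2 T' R → Iso T R T' R
Iso-sameR {n} {_} {T'} {R} R? cat cat' =
  Iso-trans {T' = CanonT g} {CanonR g} {T'} {R} (P.Iso-canonical R?)
    (Iso-trans {T' = CanonT g'} {CanonR g'} {T'} {R} canonical≅ (Iso-sym (P'.Iso-canonical R?)))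
  where
  module P  = CatalanPair cat
  module P' = CatalanPair cat'
  g g' : Fin n → ℕ
  g  = P.profile R?
  g' = P'.profile R?
  g≗g' : ∀ j → g j ≡ g' j
  g≗g' j = ≤-antisym
    (Equivalence.from (P.profile≤⇔ R? _ j) (Equivalence.to (P'.profile≤⇔ R? _ j) ≤-refl))
    (Equivalence.from (P'.profile≤⇔ R? _ j) (Equivalence.to (P.profile≤⇔ R? _ j) ≤-refl))
  canonical≅ : Iso (CanonT g) (CanonR g) (CanonT g') (CanonR g')
  canonical≅ = canonical-cong g≗g'

-- Catalan pairs from Fishburn matrices

IsCell : Cell → Set
IsCell (i , j) = i ≤ j

-- c = d, or c is weakly NW of d.
_≼_ : Cell → Cell → Set
(i , j) ≼ (i' , j') = i ≤ i' × j ≤ j' × ¬ CellGreater (i' , j') (i , j)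

_≟ᶜ_ : (c d : Cell) → Dec (c ≡ d)
_≟ᶜ_ = ≡-dec _≟_ _≟_

≼-refl : ∀ {c} → IsCell c → c ≼ c
≼-refl i≤j = ≤-refl , ≤-refl , ≤⇒≯ i≤j

≼-antisym : ∀ {c d} → c ≼ d → d ≼ c → c ≡ d
≼-antisym (i≤i' , j≤j' , _) (i'≤i , j'≤j , _) = cong₂ _,_ (≤-antisym i≤i' i'≤i) (≤-antisym j≤j' j'≤j)

WeaklyNW⇒≼ : ∀ {c d} → IsCell c → IsCell d → WeaklyNW c d → c ≼ d
WeaklyNW⇒≼ _ i'≤j' (inj₁ (i<i' , refl))           = <⇒≤ i<i' , ≤-refl , ≤⇒≯ i'≤j'
WeaklyNW⇒≼ i≤j _ (inj₂ (inj₁ (refl , j<j')))       = ≤-refl , <⇒≤ j<j' , ≤⇒≯ i≤j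
WeaklyNW⇒≼ _ _ (inj₂ (inj₂ (incomp , i<i' , j<j'))) = <⇒≤ i<i' , <⇒≤ j<j' , incomp ∘ inj₂

≼⇒WeaklyNW : ∀ {c d} → IsCell d → c ≢ d → c ≼ d → WeaklyNW c d
≼⇒WeaklyNW {i , j} {i' , j'} i'≤j' c≢d (i≤i' , j≤j' , j≮i') with m≤n⇒m<n∨m≡n i≤i' | m≤n⇒m<n∨m≡n j≤j'
... | inj₂ refl | inj₂ refl = ⊥-elim (c≢d refl)
... | inj₁ i<i' | inj₂ refl = inj₁ (i<i' , refl)
... | inj₂ refl | inj₁ j<j' = inj₂ (inj₁ (refl , j<j'))
... | inj₁ i<i' | inj₁ j<j' = inj₂ (inj₂ (incomparable , i<i' , j<j'))
  where
  incomparable : ¬ CellComparable (i , j) (i' , j')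
  incomparable (inj₁ j'<i) = <⇒≱ j'<i (≤-trans i≤i' i'≤j')
  incomparable (inj₂ j<i') = j≮i' j<i'

module IntervalOrder {n : ℕ} {R : Rel n} (ρ : MinIntervalRep R) where
  open MinIntervalRep ρ

  R⇒< : ∀ {x y} → R x y → r x < l y
  R⇒< = Equivalence.to (repr _ _)

  <⇒R : ∀ {x y} → r x < l y → R x y
  <⇒R = Equivalence.from (repr _ _)

  R? : Decidable R
  R? x y = map′ <⇒R R⇒< (r x <? l y)

  -- In a minimal representation every endpoint is used, so an interval [l y, r y]
  -- strictly inside [l x, r x] yields a ≺ y ≺ c with x incomparable to a, y and c.
  nested⇒3+1 : ∀ {x y a c} → l x < l y → r y < r x → suc (r a) ≡ l y → l c ≡ suc (r y) →
               Incomparable R x a × Incomparable R x y × Incomparable R x c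
  nested⇒3+1 {x} {y} {a} {c} lx<ly ry<rx ra+1≡ly lc≡ry+1 =
    ((λ Rxa → <-irrefl refl (begin-strict
      r x <⟨ R⇒< Rxa ⟩ l a ≤⟨ l≤r a ⟩ r a <⟨ ra<ly ⟩ l y ≤⟨ l≤r y ⟩ r y <⟨ ry<rx ⟩ r x ∎)) ,
     (λ Rax → <⇒≱ (R⇒< Rax) lx≤ra)) ,
    ((λ Rxy → <-irrefl refl (begin-strict
      r x <⟨ R⇒< Rxy ⟩ l y ≤⟨ l≤r y ⟩ r y <⟨ ry<rx ⟩ r x ∎)) ,
     (λ Ryx → <-irrefl refl (begin-strict
      r y <⟨ R⇒< Ryx ⟩ l x <⟨ lx<ly ⟩ l y ≤⟨ l≤r y ⟩ r y ∎))) ,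
    ((λ Rxc → <⇒≱ (R⇒< Rxc) lc≤rx) ,
     (λ Rcx → <-irrefl refl (begin-strict
      r c <⟨ R⇒< Rcx ⟩ l x <⟨ lx<ly ⟩ l y ≤⟨ l≤r y ⟩ r y <⟨ ry<lc ⟩ l c ≤⟨ l≤r c ⟩ r c ∎)))
    where
    open ≤-Reasoning
    ra<ly : r a < l y
    ra<ly = ≤-reflexive ra+1≡ly
    lx≤ra : l x ≤ r a
    lx≤ra = ≤-pred (subst (l x <_) (sym ra+1≡ly) lx<ly)
    ry<lc : r y < l c
    ry<lc = ≤-reflexive (sym lc≡ry+1)
    lc≤rx : l c ≤ r x
    lc≤rx = subst (_≤ r x) (sym lc≡ry+1) ry<rx

  no-strict-nesting : Free-3+1 R → ∀ {x y} → l x < l y → r y < r x → ⊥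
  no-strict-nesting free31 {x} {y} lx<ly ry<rx with l y in ly≡ | lx<ly
  ... | suc k | s≤s lx≤k
    with (a , ra≡k) ← rightEnd k (≤-trans (l-pos x) lx≤k)
                                 (≤-trans (n≤1+n k) (subst (_≤ m) ly≡ (≤-trans (l≤r y) (r≤m y))))
       | (c , lc≡ry+1) ← leftEnd (suc (r y)) (s≤s z≤n) (≤-trans ry<rx (r≤m x))
    = free31 a y c x (<⇒R (≤-reflexive ra+1≡ly)) (<⇒R (≤-reflexive (sym lc≡ry+1)))
             (nested⇒3+1 lx<ly ry<rx ra+1≡ly lc≡ry+1)
    where
    ra+1≡ly : suc (r a) ≡ l y
    ra+1≡ly = trans (cong suc ra≡k) (sym ly≡)

  module _ (free31 : Free-3+1 R) where

    ≤ˡ-overlapping⇒≼⊎≽ : ∀ {x y} → l x ≤ l y → ¬ R x y → ¬ R y x →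
                         cell ρ x ≼ cell ρ y ⊎ cell ρ y ≼ cell ρ x
    ≤ˡ-overlapping⇒≼⊎≽ {x} {y} lx≤ly ¬Rxy ¬Ryx with ≤-total (r x) (r y)
    ... | inj₁ rx≤ry = inj₁ (lx≤ly , rx≤ry , ¬Rxy ∘ <⇒R)
    ... | inj₂ ry≤rx with m≤n⇒m<n∨m≡n lx≤ly | m≤n⇒m<n∨m≡n ry≤rx
    ...   | inj₂ lx≡ly | _          = inj₂ (≤-reflexive (sym lx≡ly) , ry≤rx , ¬Ryx ∘ <⇒R)
    ...   | inj₁ _     | inj₂ ry≡rx = inj₁ (lx≤ly , ≤-reflexive (sym ry≡rx) , ¬Rxy ∘ <⇒R)
    ...   | inj₁ lx<ly | inj₁ ry<rx = ⊥-elim (no-strict-nesting free31 lx<ly ry<rx)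

    overlapping⇒≼⊎≽ : ∀ {x y} → ¬ R x y → ¬ R y x → cell ρ x ≼ cell ρ y ⊎ cell ρ y ≼ cell ρ x
    overlapping⇒≼⊎≽ {x} {y} ¬Rxy ¬Ryx with ≤-total (l x) (l y)
    ... | inj₁ lx≤ly = ≤ˡ-overlapping⇒≼⊎≽ lx≤ly ¬Rxy ¬Ryx
    ... | inj₂ ly≤lx = Sum.swap (≤ˡ-overlapping⇒≼⊎≽ ly≤lx ¬Ryx ¬Rxy)

  module _ (R-spo : IsStrictPartialOrder R) (free31 : Free-3+1 R) {T : Rel n}
           (linear : CellLinear ρ T) (nw : CellNW ρ T) (other : NoOtherPairs ρ T) where

    T⇒≼ : ∀ {x y} → T x y → cell ρ x ≼ cell ρ y
    T⇒≼ {x} {y} t with other x y t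
    ... | inj₁ same          = subst (cell ρ x ≼_) same (≼-refl (l≤r x))
    ... | inj₂ (_ , weakNW) = WeaklyNW⇒≼ (l≤r x) (l≤r y) weakNW

    ≼⇒T : ∀ {x y} → cell ρ x ≢ cell ρ y → cell ρ x ≼ cell ρ y → T x y
    ≼⇒T {x} {y} x≢y x≼y = nw x y x≢y (≼⇒WeaklyNW (l≤r y) x≢y x≼y)

    T⇒l≤ : ∀ {x y} → T x y → l x ≤ l y
    T⇒l≤ = proj₁ ∘ T⇒≼

    T⇒r≤ : ∀ {x y} → T x y → r x ≤ r y
    T⇒r≤ = proj₁ ∘ proj₂ ∘ T⇒≼

    T⇒¬R : ∀ {x y} → T x y → ¬ R x y
    T⇒¬R t = proj₂ (proj₂ (T⇒≼ t)) ∘ R⇒<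

    T⇒¬R⁻¹ : ∀ {x y} → T x y → ¬ R y x
    T⇒¬R⁻¹ {x} {y} t Ryx = <⇒≱ (R⇒< Ryx) (≤-trans (T⇒l≤ t) (l≤r y))

    TT⇒T∪R : ∀ {x y z} → T x y → T y z → (T ∪ R) x z
    TT⇒T∪R {x} {y} {z} txy tyz with r x <? l z | cell ρ x ≟ᶜ cell ρ z
    ... | yes rx<lz | _       = inj₂ (<⇒R rx<lz)
    ... | no rx≮lz  | no x≢z  =
      inj₁ (≼⇒T x≢z (≤-trans (T⇒l≤ txy) (T⇒l≤ tyz) , ≤-trans (T⇒r≤ txy) (T⇒r≤ tyz) , rx≮lz))
    ... | no _      | yes x≡z = inj₁ (proj₁ (proj₂ linear) x y z x≡y (trans (sym x≡y) x≡z) txy tyz)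
      where
      x≡y : cell ρ x ≡ cell ρ y
      x≡y = ≼-antisym (T⇒≼ txy) (subst (cell ρ y ≼_) (sym x≡z) (T⇒≼ tyz))

    cells-isCatalanPair2 : IsCatalanPair2 T R
    cells-isCatalanPair2 =
      R-spo , (L-irrefl , L-trans) , (λ _ _ x≢y → comparable x≢y , exclusive) ,
      (λ _ _ _ _ (txy , txz , Ryz) → T⇒¬R txz (<⇒R (≤-<-trans (T⇒r≤ txy) (R⇒< Ryz)))) ,
      (λ _ _ _ _ (tyx , tzx , Ryz) → T⇒¬R tyx (<⇒R (<-≤-trans (R⇒< Ryz) (T⇒l≤ tzx))))
      where
      L-irrefl : ∀ x → ¬ (T ∪ R) x x
      L-irrefl x (inj₁ t) = proj₁ linear x t
      L-irrefl x (inj₂ r) = proj₁ R-spo x r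
      L-trans : Transitive (T ∪ R)
      L-trans x y z (inj₂ Rxy) (inj₂ Ryz) = inj₂ (proj₂ R-spo x y z Rxy Ryz)
      L-trans _ _ _ (inj₁ txy) (inj₂ Ryz) = inj₂ (<⇒R (≤-<-trans (T⇒r≤ txy) (R⇒< Ryz)))
      L-trans _ _ _ (inj₂ Rxy) (inj₁ tyz) = inj₂ (<⇒R (<-≤-trans (R⇒< Rxy) (T⇒l≤ tyz)))
      L-trans _ _ _ (inj₁ txy) (inj₁ tyz) = TT⇒T∪R txy tyz
      comparable : ∀ {x y} → x ≢ y → Comparable T x y ⊎ Comparable R x y
      comparable {x} {y} x≢y with cell ρ x ≟ᶜ cell ρ y | R? x y | R? y x
      ... | yes same | _        | _        = inj₁ (proj₂ (proj₂ linear) x y same x≢y)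
      ... | no _     | yes Rxy  | _        = inj₂ (inj₁ Rxy)
      ... | no _     | no _     | yes Ryx  = inj₂ (inj₂ Ryx)
      ... | no diff  | no ¬Rxy  | no ¬Ryx  =
        inj₁ (Sum.map (≼⇒T diff) (≼⇒T (diff ∘ sym)) (overlapping⇒≼⊎≽ free31 ¬Rxy ¬Ryx))
      exclusive : ∀ {x y} → ¬ (Comparable T x y × Comparable R x y)
      exclusive (inj₁ t , inj₁ r) = T⇒¬R t r
      exclusive (inj₁ t , inj₂ r) = T⇒¬R⁻¹ t r
      exclusive (inj₂ t , inj₁ r) = T⇒¬R⁻¹ t r
      exclusive (inj₂ t , inj₂ r) = T⇒¬R t r

-- Counting isomorphism types

lookup-injective : ∀ {A : Set} {xs : List A} → Unique xs → ∀ i j → List.lookup xs i ≡ List.lookup xs j → i ≡ j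
lookup-injective (_ ∷ _)   zero    zero    _  = refl
lookup-injective (px ∷ _)  zero    (suc j) eq = ⊥-elim (All.lookup px (∈-lookup j) eq)
lookup-injective (px ∷ _)  (suc i) zero    eq = ⊥-elim (All.lookup px (∈-lookup i) (sym eq))
lookup-injective (_ ∷ xs!) (suc i) (suc j) eq = cong suc (lookup-injective xs! i j eq)

lookup-≗⇒≡ : ∀ {A : Set} {n} {xs ys : Vec A n} → (∀ i → lookup xs i ≡ lookup ys i) → xs ≡ ys
lookup-≗⇒≡ {xs = xs} {ys} eq = trans (sym (tabulate∘lookup xs)) (trans (tabulate-cong eq) (tabulate∘lookup ys))

Ballot-lookup-bounds : ∀ {m c lo} {v : Vec ℕ m} → Ballot c lo v → ∀ j → lo ≤ lookup v j × lookup v j ≤ c + toℕ j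
Ballot-lookup-bounds {c = c} {v = x ∷ _}  (lo≤x , x≤c , _) zero    =
  lo≤x , ≤-trans x≤c (≤-reflexive (sym (+-identityʳ c)))
Ballot-lookup-bounds {c = c} {v = _ ∷ xs} (lo≤x , _ , bxs) (suc j) with Ballot-lookup-bounds bxs j
... | x≤ , ≤c+1+j = ≤-trans lo≤x x≤ , ≤-trans ≤c+1+j (≤-reflexive (sym (+-suc c (toℕ j))))

Ballot-lookup-mono : ∀ {m c lo} {v : Vec ℕ m} → Ballot c lo v → ∀ {i j} → toℕ i ≤ toℕ j → lookup v i ≤ lookup v j
Ballot-lookup-mono {v = _ ∷ _}  _             {zero}  {zero}  _         = ≤-refl
Ballot-lookup-mono {v = _ ∷ _}  (_ , _ , bxs) {zero}  {suc j} _         = proj₁ (Ballot-lookup-bounds bxs j)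
Ballot-lookup-mono {v = _ ∷ _}  (_ , _ , bxs) {suc i} {suc j} (s≤s i≤j) = Ballot-lookup-mono bxs i≤j

Ballot⇒IsProfile : ∀ {n} {v : Vec ℕ n} → Ballot 0 0 v → IsProfile (lookup v)
Ballot⇒IsProfile b = record { bounded = proj₂ ∘ Ballot-lookup-bounds b ; monotone = Ballot-lookup-mono b }

tabulate-Ballot : ∀ {m} c lo (f : Fin m → ℕ) → (∀ j → lo ≤ f j) → (∀ j → f j ≤ c + toℕ j) →
                  (∀ {i j} → toℕ i ≤ toℕ j → f i ≤ f j) → Ballot c lo (tabulate f)
tabulate-Ballot {zero}  _ _ _ _ _ _ = tt
tabulate-Ballot {suc m} c lo f lower upper mono =
  lower zero , ≤-trans (upper zero) (≤-reflexive (+-identityʳ c)) ,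
  tabulate-Ballot (suc c) (f zero) (f ∘ suc) (λ j → mono {zero} {suc j} z≤n)
    (λ j → ≤-trans (upper (suc j)) (≤-reflexive (+-suc c (toℕ j)))) (λ i≤j → mono (s≤s i≤j))

IsProfile⇒Ballot : ∀ {n} {g : Fin n → ℕ} → IsProfile g → Ballot 0 0 (tabulate g)
IsProfile⇒Ballot {g = g} g-profile = tabulate-Ballot 0 0 g (λ _ → z≤n) bounded monotone
  where open IsProfile g-profile

toBRel : ∀ {n} {P : Rel n} → Decidable P → BRel n
toBRel P? x y = isYes (P? x y)

⟦toBRel⟧⇔ : ∀ {n} {P : Rel n} (P? : Decidable P) x y → ⟦ toBRel P? ⟧ x y ⇔ P x y
⟦toBRel⟧⇔ P? x y = mk⇔ toWitness fromWitness

canonTᵇ canonRᵇ : ∀ {n} → (Fin n → ℕ) → BRel n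
canonTᵇ g = toBRel (λ i j → (toℕ i <? toℕ j) ×-dec ¬? (toℕ i <? g j))
canonRᵇ g = toBRel (λ i j → toℕ i <? g j)

Iso-canonicalᵇ : ∀ {n} (g : Fin n → ℕ) → Iso ⟦ canonTᵇ g ⟧ ⟦ canonRᵇ g ⟧ (CanonT g) (CanonR g)
Iso-canonicalᵇ g = ⇔⇒Iso (⟦toBRel⟧⇔ _) (⟦toBRel⟧⇔ _)

HasIsoTypes-ballots : ∀ n → HasIsoTypes n (length (ballots n 0 0))
HasIsoTypes-ballots n = (λ i → canonTᵇ (g i) , canonRᵇ (g i)) , isCatalan , distinct , cover
  where
  vs : List (Vec ℕ n)
  vs = ballots n 0 0
  g : Fin (length vs) → Fin n → ℕ
  g i = lookup (List.lookup vs i)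
  g-isProfile : ∀ i → IsProfile (g i)
  g-isProfile i = Ballot⇒IsProfile (ballots-sound n 0 0 (∈-lookup i))
  isCatalan : ∀ i → IsCatalanPair2 ⟦ canonTᵇ (g i) ⟧ ⟦ canonRᵇ (g i) ⟧
  isCatalan i = IsCatalanPair2-pullback (Iso-canonicalᵇ (g i)) (canonical-isCatalanPair2 (g-isProfile i))
  distinct : ∀ i j → Iso ⟦ canonTᵇ (g i) ⟧ ⟦ canonRᵇ (g i) ⟧ ⟦ canonTᵇ (g j) ⟧ ⟦ canonRᵇ (g j) ⟧ → i ≡ j
  distinct i j iso =
    lookup-injective (ballots-unique n 0 0) i j (lookup-≗⇒≡ (canonical-Iso⇒≗ (g-isProfile i) (g-isProfile j) canonical≅))
    where
    canonical≅ : Iso (CanonT (g i)) (CanonR (g i)) (CanonT (g j)) (CanonR (g j))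
    canonical≅ =
      Iso-trans {T' = ⟦ canonTᵇ (g i) ⟧} {⟦ canonRᵇ (g i) ⟧} {CanonT (g j)} {CanonR (g j)}
        (Iso-sym (Iso-canonicalᵇ (g i)))
      (Iso-trans {T' = ⟦ canonTᵇ (g j) ⟧} {⟦ canonRᵇ (g j) ⟧} {CanonT (g j)} {CanonR (g j)} iso (Iso-canonicalᵇ (g j)))
  cover : ∀ (T R : BRel n) → IsCatalanPair2 ⟦ T ⟧ ⟦ R ⟧ →
          ∃ λ i → Iso ⟦ T ⟧ ⟦ R ⟧ ⟦ canonTᵇ (g i) ⟧ ⟦ canonRᵇ (g i) ⟧
  cover T R cat = i ,
    Iso-trans {T' = CanonT h} {CanonR h} {⟦ canonTᵇ (g i) ⟧} {⟦ canonRᵇ (g i) ⟧} (Pair.Iso-canonical R?)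
    (Iso-trans {T' = CanonT (g i)} {CanonR (g i)} {⟦ canonTᵇ (g i) ⟧} {⟦ canonRᵇ (g i) ⟧}
      (canonical-cong h≗gi) (Iso-sym (Iso-canonicalᵇ (g i))))
    where
    module Pair = CatalanPair cat
    R? : Decidable ⟦ R ⟧
    R? x y = T? (R x y)
    h : Fin n → ℕ
    h = Pair.profile R?
    h∈ : tabulate h ∈ vs
    h∈ = ballots-complete 0 0 (tabulate h) (IsProfile⇒Ballot (Pair.profile-isProfile R?))
    i : Fin (length vs)
    i = index h∈
    h≗gi : ∀ j → h j ≡ g i j
    h≗gi j = trans (sym (lookup∘tabulate h j)) (cong (λ v → lookup v j) (lookup-index h∈))

lemma2p5 :
    ((n : ℕ) (R : Rel n) →
      IsStrictPartialOrder R → Free-2+2 R → Free-3+1 R →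
      (ρ : MinIntervalRep R) (T : Rel n) →
      CellLinear ρ T → CellNW ρ T → NoOtherPairs ρ T →
      IsCatalanPair2 T R
      × ((T' : Rel n) → IsCatalanPair2 T' R → Iso T R T' R))
    × ((n : ℕ) → HasIsoTypes n (catalan n))
lemma2p5 =
  (λ _ _ R-spo _ free31 ρ _ linear nw other →
    let cat = IntervalOrder.cells-isCatalanPair2 ρ R-spo free31 linear nw other
    in  cat , λ _ cat' → Iso-sameR (IntervalOrder.R? ρ) cat cat') ,
  λ n → subst (HasIsoTypes n) (trans (length-ballots n 0 0) (sym (catalan≡ballotNumber n))) (HasIsoTypes-ballots n)
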